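{- Let $T$ be a tree-network and let $H$ be a tree decomposition for $T$ with pivot size $\theta$ and depth $\ell$. Then $H$ can be transformed into a layered decomposition $(\sigma,\pi)$ of $T$ with critical set size $\Delta=2(\theta+1)$ and length $\ell$.
   Context: Let $T$ be a tree on vertex set $V$, and let $\mathcal{D}(T)$ be a set of paths in $T$ (demand instances), with $\mathrm{path}(d)$ the path of $d$. Two instances overlap if their paths share an edge. Tree decomposition: a rooted tree $H$ on $V$ with root $g$. The depth of a node is the number of nodes on its root path (the root has depth $1$), and the depth of $H$ is the maximum depth. $C(z)$ is $z$ together with its descendants. $H$ is a tree decomposition if (i) whenever $d\in\mathcal{D}(T)$ passes through $x$ and $y$, it passes through their least common ancestor in $H$, and (ii) each $C(z)$ induces a connected subtree of $T$. The pivot set $\chi(z)$ is the set of vertices outside $C(z)$ adjacent in $T$ to $C(z)$, and the pivot size is $\max_z|\chi(z)|$. Layered decomposition of $T$: a pair $(\sigma,\pi)$, where $\sigma$ is a partition of $\mathcal{D}(T)$ into a sequence of groups $G_1,\dots,G_\ell$ ($\ell$ is its length), and $\pi$ maps each $d$ to a subset $\pi(d)$ of edges of $\mathrm{path}(d)$ (critical edges). These must satisfy: for all $1\le i\le j\le \ell$, all $d_1\in G_i$ and all $d_2\in G_j$, if $d_1,d_2$ overlap then $\mathrm{path}(d_2)$ contains an edge of $\pi(d_1)$. The critical set size is $\Delta=\max_d|\pi(d)|$. -}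

module Defs where

open import Data.Nat using (ℕ; suc; _≤_)
open import Data.Fin using (Fin; toℕ)
open import Data.List using (List; []; _∷_; length)
open import Data.List.Membership.Propositional using (_∈_)
open import Data.List.Relation.Unary.All using (All)
open import Data.List.Relation.Unary.Any using (Any)
open import Data.List.Relation.Unary.Unique.Propositional using (Unique)
open import Data.Product using (Σ; ∃; _×_; _,_; proj₁; proj₂)
open import Data.Sum using (_⊎_)
open import Relation.Binary.PropositionalEquality using (_≡_; _≢_)
open import Relation.Nullary using (¬_)

Edges : ℕ → Set
Edges n = List (Fin n × Fin n)

Adj : ∀ {n} → Edges n → Fin n → Fin n → Set
Adj E a b = (a , b) ∈ E ⊎ (b , a) ∈ E

data Walk {n} (E : Edges n) : Fin n → Fin n → List (Fin n) → Set where
  single : ∀ {u} → Walk E u u (u ∷ [])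
  cons   : ∀ {u w v p} → Adj E u w → Walk E w v p → Walk E u v (u ∷ p)

IsTree : ∀ {n} → Edges n → Set
IsTree {n} E =
  (∀ a b → Adj E a b → a ≢ b)
  × (∀ u v → ∃ λ p → Walk E u v p)
  × (∀ u v p q → Walk E u v p → Unique p → Walk E u v q → Unique q → p ≡ q)

record Demand {n} (E : Edges n) : Set where
  field
    src dst : Fin n
    vs      : List (Fin n)
    walk    : Walk E src dst vs
    simple  : Unique vs
open Demand public

data Consec {n} : List (Fin n) → Fin n → Fin n → Set where
  here  : ∀ {a b rest} → Consec (a ∷ b ∷ rest) a b
  there : ∀ {x rest a b} → Consec rest a b → Consec (x ∷ rest) a b

EdgeIn : ∀ {n} → List (Fin n) → Fin n → Fin n → Set
EdgeIn p a b = Consec p a b ⊎ Consec p b a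

Overlap : ∀ {n} {E : Edges n} → Demand E → Demand E → Set
Overlap d₁ d₂ = ∃ λ a → ∃ λ b → EdgeIn (vs d₁) a b × EdgeIn (vs d₂) a b

-- Rooted tree H on V, given by a root g and a parent map par
-- (par g is irrelevant).

-- RootDepth g par v k : the root path of v in H has exactly k nodes
data RootDepth {n} (g : Fin n) (par : Fin n → Fin n) : Fin n → ℕ → Set where
  root : RootDepth g par g 1
  step : ∀ {v k} → v ≢ g → RootDepth g par (par v) k → RootDepth g par v (suc k)

IsRootedTree : ∀ {n} → Fin n → (Fin n → Fin n) → Set
IsRootedTree g par = ∀ v → ∃ λ k → RootDepth g par v k

-- Anc g par z v : z is an ancestor of v or z = v, i.e. v ∈ C(z)
data Anc {n} (g : Fin n) (par : Fin n → Fin n) (z : Fin n) : Fin n → Set where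
  self : Anc g par z z
  up   : ∀ {v} → v ≢ g → Anc g par z (par v) → Anc g par z v

IsLCA : ∀ {n} → Fin n → (Fin n → Fin n) → Fin n → Fin n → Fin n → Set
IsLCA g par x y w =
  Anc g par w x × Anc g par w y
  × (∀ w' → Anc g par w' x → Anc g par w' y → Anc g par w' w)

InducesConnected : ∀ {n} → Edges n → (Fin n → Set) → Set
InducesConnected E S =
  ∀ u v → S u → S v → ∃ λ p → Walk E u v p × All S p

IsTreeDecomp : ∀ {n m} (E : Edges n) → (Fin m → Demand E)
               → Fin n → (Fin n → Fin n) → Set
IsTreeDecomp {n} {m} E D g par =
  IsRootedTree g par
  × (∀ (d : Fin m) x y w → x ∈ vs (D d) → y ∈ vs (D d)
       → IsLCA g par x y w → w ∈ vs (D d))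
  × (∀ z → InducesConnected E (Anc g par z))

Pivot : ∀ {n} → Edges n → Fin n → (Fin n → Fin n) → Fin n → Fin n → Set
Pivot E g par z v = ¬ Anc g par z v × ∃ λ u → Anc g par z u × Adj E u v

HasSize : ∀ {n} → (Fin n → Set) → ℕ → Set
HasSize {n} P k = Σ (List (Fin n)) λ xs →
  Unique xs × (∀ v → v ∈ xs → P v) × (∀ v → P v → v ∈ xs) × length xs ≡ k

PivotSize : ∀ {n} → Edges n → Fin n → (Fin n → Fin n) → ℕ → Set
PivotSize E g par θ =
  (∀ z k → HasSize (Pivot E g par z) k → k ≤ θ)
  × ∃ λ z → HasSize (Pivot E g par z) θ

Depth : ∀ {n} → Fin n → (Fin n → Fin n) → ℕ → Set
Depth g par ℓ = (∀ v k → RootDepth g par v k → k ≤ ℓ) × ∃ λ v → RootDepth g par v ℓ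

-- Layered decomposition (σ, π) of length ℓ:
-- σ is given by grp : D → Fin ℓ (d ∈ G_{grp d + 1}; groups may be empty),
-- π d is a list of edges (pairs of endpoints) of path(d).

IsLayeredDecomp : ∀ {n m} (E : Edges n) → (Fin m → Demand E) → (ℓ : ℕ)
                  → (Fin m → Fin ℓ) → (Fin m → List (Fin n × Fin n)) → Set
IsLayeredDecomp {n} {m} E D ℓ grp π =
  (∀ d → All (λ e → EdgeIn (vs (D d)) (proj₁ e) (proj₂ e)) (π d))
  × (∀ d₁ d₂ → toℕ (grp d₁) ≤ toℕ (grp d₂) → Overlap (D d₁) (D d₂)
       → Any (λ e → EdgeIn (vs (D d₂)) (proj₁ e) (proj₂ e)) (π d₁))

CriticalSizeAtMost : ∀ {n m} → (Fin m → List (Fin n × Fin n)) → ℕ → Set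
CriticalSizeAtMost π Δ = ∀ d → length (π d) ≤ Δ

module Submission where

-- For a demand d let t(d) be its shallowest vertex in H.  Paths are closed under
-- least common ancestors, so t(d) is an ancestor of all of path(d).  Demands are
-- layered by decreasing depth of t(d), and the critical edges of d are the (at
-- most two) edges of path(d) at the gate of q, for q = t(d) and for each pivot
-- q of t(d); the gate of q is where a walk from q first reaches path(d).
-- If d₁ is layered no later than d₂ and their paths share an edge, some such q
-- lies on path(d₂): either t(d₁) = t(d₂), or path(d₂) leaves C(t(d₁)) through a
-- pivot.  As T is a tree, the part of path(d₂) from q to the shared edge runs
-- through the gate of q and then along path(d₁), so it contains an edge of
-- path(d₁) at the gate.

open import Defs
open import Data.Nat using (ℕ; suc; _+_; _*_; _≤_; _<_; z≤n; s≤s)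
open import Data.Nat.Properties
  using (≤-reflexive; +-mono-≤; *-suc; *-monoʳ-≤; +-comm; m≤n⇒m≤1+n; ≤⇒≯;
         ∸-monoʳ-<; ∸-cancelʳ-≤; module ≤-Reasoning)
open import Data.Fin using (Fin; toℕ; fromℕ<; _≟_)
open import Data.Fin.Properties using (any?; toℕ-fromℕ<)
open import Data.List using (List; []; _∷_; _++_; _∷ʳ_; length; reverse; filter; allFin; concatMap)
open import Data.List.Properties using (length-++; unfold-reverse; reverse-++; reverse-involutive)
open import Data.List.Extrema.Nat using (argmin; argmin-sel; f[argmin]≤f[xs])
open import Data.List.Membership.Propositional using (_∈_; _∉_; lose)
open import Data.List.Membership.Propositional.Properties
  using (∈-∃++; ∈-++⁺ˡ; ∈-++⁺ʳ; ∈-++⁻; ∈-filter⁺; ∈-filter⁻; ∈-allFin)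
open import Data.List.Relation.Binary.Subset.Propositional using (_⊆_)
open import Data.List.Relation.Unary.All using (All; []; _∷_)
import Data.List.Relation.Unary.All as All
import Data.List.Relation.Unary.All.Properties as All
open import Data.List.Relation.Unary.Any using (Any; here; there)
import Data.List.Relation.Unary.Any.Properties as Any
open import Data.List.Relation.Unary.AllPairs using ([]; _∷_)
open import Data.List.Relation.Unary.Unique.Propositional using (Unique)
open import Data.List.Relation.Unary.Unique.Propositional.Properties using (++⁺; filter⁺; allFin⁺)
open import Data.Product using (Σ; ∃; _×_; _,_; proj₁; proj₂)
import Data.Product as Product
open import Data.Product.Properties using (≡-dec)
open import Data.Sum using (_⊎_; inj₁; inj₂; [_,_]′)
import Data.Sum as Sum
open import Data.Empty using (⊥-elim)
open import Relation.Nullary using (¬_; Dec; yes; no)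
open import Relation.Nullary.Decidable using (¬?; _×-dec_; _⊎-dec_)
open import Relation.Unary using (Decidable)
open import Relation.Binary.PropositionalEquality using (_≡_; _≢_; refl; sym; cong; subst; subst₂)

module _ {A : Set} where

  Unique-++⁻ʳ : ∀ (xs : List A) {ys} → Unique (xs ++ ys) → Unique ys
  Unique-++⁻ʳ []       u       = u
  Unique-++⁻ʳ (x ∷ xs) (_ ∷ u) = Unique-++⁻ʳ xs u

  Unique-reverse : ∀ {xs : List A} → Unique xs → Unique (reverse xs)
  Unique-reverse {[]}     []        = []
  Unique-reverse {x ∷ xs} (x∉xs ∷ u) rewrite unfold-reverse x xs =
    ++⁺ (Unique-reverse u) ([] ∷ []) λ { (x∈ , here refl) → All.lookup x∉xs (Any.reverse⁻ x∈) refl }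

length-concatMap-≤ : ∀ {A B : Set} (f : A → List B) {k} → (∀ x → length (f x) ≤ k) →
                     ∀ xs → length (concatMap f xs) ≤ k * length xs
length-concatMap-≤ f     bound []       = z≤n
length-concatMap-≤ f {k} bound (x ∷ xs) = begin
  length (f x ++ concatMap f xs)          ≡⟨ length-++ (f x) ⟩
  length (f x) + length (concatMap f xs)  ≤⟨ +-mono-≤ (bound x) (length-concatMap-≤ f bound xs) ⟩
  k + k * length xs                       ≡⟨ sym (*-suc k (length xs)) ⟩
  k * suc (length xs)                     ∎
  where open ≤-Reasoning

module _ {n : ℕ} where
  open import Data.List.Membership.DecPropositional (_≟_ {n}) using (_∈?_)

  EdgeOf : List (Fin n) → Fin n × Fin n → Set
  EdgeOf p e = EdgeIn p (proj₁ e) (proj₂ e)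

  Consec-∈ : ∀ {p : List (Fin n)} {a b} → Consec p a b → a ∈ p × b ∈ p
  Consec-∈ here      = here refl , there (here refl)
  Consec-∈ (there c) = Product.map there there (Consec-∈ c)

  EdgeIn-∈ : ∀ {p : List (Fin n)} {a b} → EdgeIn p a b → a ∈ p × b ∈ p
  EdgeIn-∈ (inj₁ c) = Consec-∈ c
  EdgeIn-∈ (inj₂ c) = Product.swap (Consec-∈ c)

  EdgeIn-sym : ∀ {p : List (Fin n)} {a b} → EdgeIn p a b → EdgeIn p b a
  EdgeIn-sym = Sum.swap

  Consec-++⁺ˡ : ∀ {xs ys : List (Fin n)} {a b} → Consec xs a b → Consec (xs ++ ys) a b
  Consec-++⁺ˡ here      = here
  Consec-++⁺ˡ (there c) = there (Consec-++⁺ˡ c)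

  Consec-++⁺ʳ : ∀ (xs : List (Fin n)) {ys a b} → Consec ys a b → Consec (xs ++ ys) a b
  Consec-++⁺ʳ []       c = c
  Consec-++⁺ʳ (x ∷ xs) c = there (Consec-++⁺ʳ xs c)

  Consec-reverse : ∀ {xs : List (Fin n)} {a b} → Consec xs a b → Consec (reverse xs) b a
  Consec-reverse {a ∷ b ∷ r} here =
    subst (λ l → Consec l b a) (sym (reverse-++ (a ∷ b ∷ []) r)) (Consec-++⁺ʳ (reverse r) here)
  Consec-reverse {x ∷ xs} (there c) =
    subst (λ l → Consec l _ _) (sym (unfold-reverse x xs)) (Consec-++⁺ˡ (Consec-reverse c))

  Consec-reverse⁻ : ∀ {xs : List (Fin n)} {a b} → Consec (reverse xs) a b → Consec xs b a
  Consec-reverse⁻ {xs} c = subst (λ l → Consec l _ _) (reverse-involutive xs) (Consec-reverse c)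

  -- The edges of a ∷ p at x.  The scan stops at the edge leaving x, so it never
  -- returns more than two edges, even on lists that are not simple.
  edgesFrom : Fin n → Fin n → List (Fin n) → List (Fin n × Fin n)
  edgesFrom x a []      = []
  edgesFrom x a (b ∷ p) with a ≟ x | b ≟ x
  ... | yes _ | _     = (a , b) ∷ []
  ... | no _  | yes _ = (a , b) ∷ edgesFrom x b p
  ... | no _  | no _  = edgesFrom x b p

  edgesAt : Fin n → List (Fin n) → List (Fin n × Fin n)
  edgesAt x []      = []
  edgesAt x (a ∷ p) = edgesFrom x a p

  length-edgesFrom-self : ∀ x p → length (edgesFrom x x p) ≤ 1
  length-edgesFrom-self x []      = z≤n
  length-edgesFrom-self x (_ ∷ _) with x ≟ x
  ... | yes _   = s≤s z≤n
  ... | no x≢x = ⊥-elim (x≢x refl)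

  length-edgesFrom : ∀ x a p → length (edgesFrom x a p) ≤ 2
  length-edgesFrom x a []      = z≤n
  length-edgesFrom x a (b ∷ p) with a ≟ x | b ≟ x
  ... | yes _ | _        = s≤s z≤n
  ... | no _  | yes refl = s≤s (length-edgesFrom-self b p)
  ... | no _  | no _     = length-edgesFrom x b p

  length-edgesAt : ∀ x p → length (edgesAt x p) ≤ 2
  length-edgesAt x []      = z≤n
  length-edgesAt x (a ∷ p) = length-edgesFrom x a p

  edgesFrom-sound : ∀ x a p → All (λ e → Consec (a ∷ p) (proj₁ e) (proj₂ e)) (edgesFrom x a p)
  edgesFrom-sound x a []      = []
  edgesFrom-sound x a (b ∷ p) with a ≟ x | b ≟ x
  ... | yes _ | _     = here ∷ []
  ... | no _  | yes _ = here ∷ All.map there (edgesFrom-sound x b p)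
  ... | no _  | no _  = All.map there (edgesFrom-sound x b p)

  edgesAt-sound : ∀ x p → All (EdgeOf p) (edgesAt x p)
  edgesAt-sound x []      = []
  edgesAt-sound x (a ∷ p) = All.map inj₁ (edgesFrom-sound x a p)

  edgesFrom-leaving : ∀ {x y} a p → Unique (a ∷ p) → Consec (a ∷ p) x y → (x , y) ∈ edgesFrom x a p
  edgesFrom-leaving a (b ∷ p) _ here with a ≟ a
  ... | yes _   = here refl
  ... | no a≢a = ⊥-elim (a≢a refl)
  edgesFrom-leaving {x} a (b ∷ p) (a∉ ∷ u) (there c) with a ≟ x | b ≟ x
  ... | yes refl | _     = ⊥-elim (All.lookup a∉ (proj₁ (Consec-∈ c)) refl)
  ... | no _     | yes _ = there (edgesFrom-leaving b p u c)
  ... | no _     | no _  = edgesFrom-leaving b p u c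

  edgesFrom-entering : ∀ {x y} a p → Unique (a ∷ p) → Consec (a ∷ p) y x → (y , x) ∈ edgesFrom x a p
  edgesFrom-entering a (b ∷ p) (a∉ ∷ _) here with a ≟ b | b ≟ b
  ... | yes refl | _       = ⊥-elim (All.lookup a∉ (here refl) refl)
  ... | no _     | yes _   = here refl
  ... | no _     | no b≢b = ⊥-elim (b≢b refl)
  edgesFrom-entering {x} a (b ∷ p) (a∉ ∷ u) (there c) with a ≟ x | b ≟ x
  ... | yes refl | _     = ⊥-elim (All.lookup a∉ (proj₂ (Consec-∈ c)) refl)
  ... | no _     | yes _ = there (edgesFrom-entering b p u c)
  ... | no _     | no _  = edgesFrom-entering b p u c

  edgesAt-hits : ∀ {p q : List (Fin n)} {x y} → Unique p → EdgeIn p x y → EdgeIn q x y →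
                 Any (EdgeOf q) (edgesAt x p)
  edgesAt-hits {a ∷ p} u (inj₁ c) xy = lose (edgesFrom-leaving a p u c) xy
  edgesAt-hits {a ∷ p} u (inj₂ c) xy = lose (edgesFrom-entering a p u c) (EdgeIn-sym xy)

  -- d is returned when W avoids P.
  firstIn : List (Fin n) → List (Fin n) → Fin n → Fin n
  firstIn P []      d = d
  firstIn P (w ∷ W) d with w ∈? P
  ... | yes _ = w
  ... | no _  = firstIn P W d

module Walks {n : ℕ} {E : Edges n} where
  open import Data.List.Membership.DecPropositional (_≟_ {n}) using (_∈?_)

  adj-sym : ∀ {a b} → Adj E a b → Adj E b a
  adj-sym = Sum.swap

  walk-head : ∀ {u v p} → Walk E u v p → u ∈ p
  walk-head single     = here refl
  walk-head (cons _ _) = here refl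

  walk-start : ∀ {s e u p} → Walk E s e (u ∷ p) → s ≡ u
  walk-start single     = refl
  walk-start (cons _ _) = refl

  walk-last : ∀ {u v p} → Walk E u v p → v ∈ p
  walk-last single     = here refl
  walk-last (cons _ w) = there (walk-last w)

  walk-∷ʳ : ∀ {u v x p} → Walk E u v p → Adj E v x → Walk E u x (p ∷ʳ x)
  walk-∷ʳ single     vx = cons vx single
  walk-∷ʳ (cons a w) vx = cons a (walk-∷ʳ w vx)

  walk-++ : ∀ {u x v p r} → Walk E u x p → Walk E x v (x ∷ r) → Walk E u v (p ++ r)
  walk-++ single     w′ = w′
  walk-++ (cons a w) w′ = cons a (walk-++ w w′)

  walk-suffix : ∀ l {s e x r} → Walk E s e (l ++ x ∷ r) → Walk E x e (x ∷ r)
  walk-suffix []          w          with refl ← walk-start w = w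
  walk-suffix (_ ∷ [])    (cons _ w) with refl ← walk-start w = w
  walk-suffix (_ ∷ y ∷ l) (cons _ w) = walk-suffix (y ∷ l) w

  walk-reverse : ∀ {u v p} → Walk E u v p → Walk E v u (reverse p)
  walk-reverse single                     = single
  walk-reverse (cons {u = u} {p = p} a w) rewrite unfold-reverse u p =
    walk-∷ʳ (walk-reverse w) (adj-sym a)

  Consec-adj : ∀ {u v p a b} → Walk E u v p → Consec p a b → Adj E a b
  Consec-adj (cons a single)     here      = a
  Consec-adj (cons a (cons _ _)) here      = a
  Consec-adj (cons _ w)          (there c) = Consec-adj w c
  Consec-adj single              (there ())

  EdgeIn-adj : ∀ {u v p a b} → Walk E u v p → EdgeIn p a b → Adj E a b
  EdgeIn-adj w (inj₁ c) = Consec-adj w c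
  EdgeIn-adj w (inj₂ c) = adj-sym (Consec-adj w c)

  Consec-head : ∀ {s w e p} → Walk E w e p → Consec (s ∷ p) s w
  Consec-head single     = here
  Consec-head (cons _ _) = here

  Consec-tail : ∀ {s w e p a b} → Walk E w e p → Consec (s ∷ p) a b → (a ≡ s × b ≡ w) ⊎ Consec p a b
  Consec-tail single     here      = inj₁ (refl , refl)
  Consec-tail (cons _ _) here      = inj₁ (refl , refl)
  Consec-tail _          (there c) = inj₂ c

  Consec-∷ʳ : ∀ {u v x p a b} → Walk E u v p → Consec (p ∷ʳ x) a b → Consec p a b ⊎ (a ≡ v × b ≡ x)
  Consec-∷ʳ single              here              = inj₂ (refl , refl)
  Consec-∷ʳ single              (there (there ()))
  Consec-∷ʳ (cons _ single)     here              = inj₁ here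
  Consec-∷ʳ (cons _ (cons _ _)) here              = inj₁ here
  Consec-∷ʳ (cons _ w)          (there c)         = Sum.map₁ there (Consec-∷ʳ w c)

  Consec-join : ∀ {q x y v W V} → Walk E q x W → Walk E y v V → Consec (W ++ V) x y
  Consec-join single     single     = here
  Consec-join single     (cons _ _) = here
  Consec-join (cons _ w) w′         = there (Consec-join w w′)

  record Subpath (P : List (Fin n)) (u v : Fin n) : Set where
    field
      vertices : List (Fin n)
      walks    : Walk E u v vertices
      unique   : Unique vertices
      ⊆path    : vertices ⊆ P
      edges⊆   : ∀ {a b} → Consec vertices a b → EdgeIn P a b
  open Subpath public

  Subpath-refl : ∀ {P u} → u ∈ P → Subpath P u u
  Subpath-refl u∈ = record
    { vertices = _ ∷ []
    ; walks    = single
    ; unique   = [] ∷ []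
    ; ⊆path    = λ { (here refl) → u∈ }
    ; edges⊆   = λ { (there ()) }
    }

  Subpath-there : ∀ {x P u v} → Subpath P u v → Subpath (x ∷ P) u v
  Subpath-there S = record
    { vertices = vertices S
    ; walks    = walks S
    ; unique   = unique S
    ; ⊆path    = λ z∈ → there (⊆path S z∈)
    ; edges⊆   = λ c → Sum.map there there (edges⊆ S c)
    }

  Subpath-reverse : ∀ {P u v} → Subpath P u v → Subpath P v u
  Subpath-reverse S = record
    { vertices = reverse (vertices S)
    ; walks    = walk-reverse (walks S)
    ; unique   = Unique-reverse (unique S)
    ; ⊆path    = λ z∈ → ⊆path S (Any.reverse⁻ z∈)
    ; edges⊆   = λ c → EdgeIn-sym (edges⊆ S (Consec-reverse⁻ c))
    }

  Subpath-∷ʳ : ∀ {s e P u v x} → Walk E s e P → (S : Subpath P u v) → EdgeIn P v x →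
               x ∉ vertices S → Subpath P u x
  Subpath-∷ʳ wP S vx x∉ = record
    { vertices = vertices S ∷ʳ _
    ; walks    = walk-∷ʳ (walks S) (EdgeIn-adj wP vx)
    ; unique   = ++⁺ (unique S) ([] ∷ []) λ { (x∈ , here refl) → x∉ x∈ }
    ; ⊆path    = λ z∈ → [ ⊆path S , (λ { (here refl) → proj₂ (EdgeIn-∈ vx) }) ]′ (∈-++⁻ (vertices S) z∈)
    ; edges⊆   = λ c → [ edges⊆ S , (λ { (refl , refl) → vx }) ]′ (Consec-∷ʳ (walks S) c)
    }

  initialSegment : ∀ {s e P v} → Walk E s e P → Unique P → v ∈ P → Subpath P s v
  initialSegment w          _          (here refl) with refl ← walk-start w = Subpath-refl (here refl)
  initialSegment single     _          (there ())
  initialSegment (cons a w) (s∉P ∷ uP) (there v∈)  = record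
    { vertices = _ ∷ vertices S
    ; walks    = cons a (walks S)
    ; unique   = All.tabulate (λ z∈ → All.lookup s∉P (⊆path S z∈)) ∷ unique S
    ; ⊆path    = λ { (here refl) → here refl ; (there z∈) → there (⊆path S z∈) }
    ; edges⊆   = λ c → [ (λ { (refl , refl) → inj₁ (Consec-head w) })
                         , (λ c′ → Sum.map there there (edges⊆ S c′))
                         ]′ (Consec-tail (walks S) c)
    }
    where S = initialSegment w uP v∈

  subpath : ∀ {s e P u v} → Walk E s e P → Unique P → u ∈ P → v ∈ P → Subpath P u v
  subpath w          uP       (here refl) v∈          with refl ← walk-start w =
    initialSegment w uP v∈
  subpath w          uP       (there u∈)  (here refl) with refl ← walk-start w =
    Subpath-reverse (initialSegment w uP (there u∈))
  subpath (cons _ w) (_ ∷ uP) (there u∈)  (there v∈)  = Subpath-there (subpath w uP u∈ v∈)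
  subpath single     _        (there ())  (there _)

  loopErase : ∀ {u v W} → Walk E u v W → ∃ λ W′ → Walk E u v W′ × Unique W′ × W′ ⊆ W
  loopErase single = _ , single , [] ∷ [] , λ z∈ → z∈
  loopErase (cons {u} a w) with loopErase w
  ... | W′ , w′ , uW′ , W′⊆ with u ∈? W′
  ...   | no u∉ = u ∷ W′ , cons a w′ , All.¬Any⇒All¬ W′ u∉ ∷ uW′ ,
                  λ { (here refl) → here refl ; (there z∈) → there (W′⊆ z∈) }
  ...   | yes u∈ with l , r , refl ← ∈-∃++ u∈ =
                  u ∷ r , walk-suffix l w′ , Unique-++⁻ʳ l uW′ , λ z∈ → there (W′⊆ (∈-++⁺ʳ l z∈))

  EntryPath : List (Fin n) → Fin n → Fin n → Set
  EntryPath P q x = ∃ λ W → Walk E q x W × Unique W × (∀ {z} → z ∈ W → z ∈ P → z ≡ x)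

  walkTo-firstIn : ∀ P {q s W} d → Walk E q s W → s ∈ P →
                    firstIn P W d ∈ P ×
                    ∃ λ W₁ → Walk E q (firstIn P W d) W₁ × (∀ {z} → z ∈ W₁ → z ∈ P → z ≡ firstIn P W d)
  walkTo-firstIn P d (single {u}) s∈ with u ∈? P
  ... | yes u∈ = u∈ , _ , single , λ { (here refl) _ → refl }
  ... | no u∉  = ⊥-elim (u∉ s∈)
  walkTo-firstIn P d (cons {u} a w) s∈ with u ∈? P
  ... | yes u∈ = u∈ , _ , single , λ { (here refl) _ → refl }
  ... | no u∉ with x∈ , W₁ , w₁ , only ← walkTo-firstIn P d w s∈ =
        x∈ , u ∷ W₁ , cons a w₁ , λ { (here refl) u∈ → ⊥-elim (u∉ u∈) ; (there z∈) → only z∈ }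

  entryPath : ∀ P {q s W} d → Walk E q s W → s ∈ P → firstIn P W d ∈ P × EntryPath P q (firstIn P W d)
  entryPath P d w s∈ with x∈ , _ , w₁ , only ← walkTo-firstIn P d w s∈
                     with W₂ , w₂ , u₂ , W₂⊆ ← loopErase w₁ =
    x∈ , W₂ , w₂ , u₂ , λ z∈ → only (W₂⊆ z∈)

  walk-leaves : ∀ {P : Fin n → Set} → Decidable P → ∀ {s e p} → Walk E s e p → P s → ¬ P e →
                ∃ λ v → v ∈ p × ¬ P v × ∃ λ u → P u × Adj E u v
  walk-leaves P? single                          Ps ¬Pe = ⊥-elim (¬Pe Ps)
  walk-leaves P? (cons {u = s} {w = w} sw walk′) Ps ¬Pe with P? w
  ... | yes Pw = Product.map₂ (Product.map₁ there) (walk-leaves P? walk′ Pw ¬Pe)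
  ... | no ¬Pw = w , there (walk-head walk′) , ¬Pw , s , Ps , sw

module TreeGeometry {n : ℕ} {E : Edges n} (tree : IsTree E) where
  open Walks {n} {E}
  open import Data.List.Membership.DecPropositional (_≟_ {n}) using (_∈?_)

  private
    loopless : ∀ a b → Adj E a b → a ≢ b
    loopless = proj₁ tree

    simple-walks-unique : ∀ u v p q → Walk E u v p → Unique p → Walk E u v q → Unique q → p ≡ q
    simple-walks-unique = proj₂ (proj₂ tree)

  -- W continued along V is a simple walk from q to c′ (W meets V ⊆ P only at x),
  -- so it is R, and the first step x → y of V is a step of R.  If V is trivial,
  -- then R = W meets P only at x = c′, which c ∈ R ∩ P forbids.
  entryEdge : ∀ {P q x c c′ R V} → EntryPath P q x →
              Walk E q c′ R → Unique R → c ∈ R → c ≢ c′ → c ∈ P →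
              Walk E x c′ V → Unique V → V ⊆ P →
              ∃ λ y → Consec V x y × Consec R x y
  entryEdge (W , wW , uW , only) wR uR c∈R c≢c′ c∈P single _ _ =
    ⊥-elim (c≢c′ (only (subst (_ ∈_) (sym (simple-walks-unique _ _ _ _ wW uW wR uR)) c∈R) c∈P))
  entryEdge {x = x} (W , wW , uW , only) wR uR _ _ _ (cons {w = y} {p = V′} xy wV′) (x∉V′ ∷ uV′) V⊆P =
    y , Consec-head wV′ ,
    subst (λ L → Consec L x y) (simple-walks-unique _ _ _ _ (walk-++ wW (cons xy wV′)) uWV′ wR uR)
          (Consec-join wW wV′)
    where
    uWV′ : Unique (W ++ V′)
    uWV′ = ++⁺ uW uV′ λ (z∈W , z∈V′) → All.lookup x∉V′ z∈V′ (sym (only z∈W (V⊆P (there z∈V′))))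

  gateEdge : ∀ {s e P Q q x c c′} → Walk E s e P → Unique P → x ∈ P → EntryPath P q x →
             (R : Subpath Q q c′) → c ∈ vertices R → EdgeIn P c c′ →
             ∃ λ y → EdgeIn P x y × EdgeIn Q x y
  gateEdge wP uP x∈ entry R c∈R cc′ =
    let c∈ , c′∈      = EdgeIn-∈ cc′
        S             = subpath wP uP x∈ c′∈
        y , xyS , xyR = entryEdge entry (walks R) (unique R) c∈R (loopless _ _ (EdgeIn-adj wP cc′)) c∈
                                  (walks S) (unique S) (⊆path S)
    in y , edges⊆ S xyS , edges⊆ R xyR

  record Traversal (P : List (Fin n)) (q a b : Fin n) : Set where
    field
      near far   : Fin n
      same-edge  : ∀ {Q} → EdgeIn Q a b → EdgeIn Q near far
      route      : Subpath P q far
      near∈route : near ∈ vertices route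

  traversal : ∀ {s e P q a b} → Walk E s e P → Unique P → q ∈ P → EdgeIn P a b → Traversal P q a b
  traversal {P = P} {q} {a} {b} wP uP q∈ ab = extend (subpath wP uP q∈ (proj₁ (EdgeIn-∈ ab)))
    where
    extend : Subpath P q a → Traversal P q a b
    extend S with b ∈? vertices S
    ... | yes b∈ = record { same-edge = EdgeIn-sym ; route = S ; near∈route = b∈ }
    ... | no b∉  = record { same-edge = λ e → e ; route = Subpath-∷ʳ wP S ab b∉
                          ; near∈route = ∈-++⁺ˡ (walk-last (walks S)) }

  sharedEdgeAtGate : ∀ {s₁ e₁ P₁ s₂ e₂ P₂ q a b W} →
                     Walk E s₁ e₁ P₁ → Unique P₁ → Walk E s₂ e₂ P₂ → Unique P₂ →
                     q ∈ P₂ → Walk E q s₁ W → EdgeIn P₁ a b → EdgeIn P₂ a b →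
                     ∃ λ y → EdgeIn P₁ (firstIn P₁ W q) y × EdgeIn P₂ (firstIn P₁ W q) y
  sharedEdgeAtGate w₁ u₁ w₂ u₂ q∈ wq ab₁ ab₂ =
    let x∈ , entry = entryPath _ _ wq (walk-head w₁)
        open Traversal (traversal w₂ u₂ q∈ ab₂)
    in gateEdge w₁ u₁ x∈ entry route near∈route (same-edge ab₁)

module RootedTree {n : ℕ} (g : Fin n) (par : Fin n → Fin n) where

  RootDepth-unique : ∀ {v k k′} → RootDepth g par v k → RootDepth g par v k′ → k ≡ k′
  RootDepth-unique root         root         = refl
  RootDepth-unique root         (step g≢g _) = ⊥-elim (g≢g refl)
  RootDepth-unique (step g≢g _) root         = ⊥-elim (g≢g refl)
  RootDepth-unique (step _ r)   (step _ r′)  = cong suc (RootDepth-unique r r′)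

  RootDepth-pos : ∀ {v k} → RootDepth g par v k → 0 < k
  RootDepth-pos root       = s≤s z≤n
  RootDepth-pos (step _ _) = s≤s z≤n

  Anc⇒depth-≤ : ∀ {z v k k′} → Anc g par z v → RootDepth g par v k → RootDepth g par z k′ → k′ ≤ k
  Anc⇒depth-≤ self       rv          rz = ≤-reflexive (RootDepth-unique rz rv)
  Anc⇒depth-≤ (up v≢g _) root        _  = ⊥-elim (v≢g refl)
  Anc⇒depth-≤ (up _ a)   (step _ rv) rz = m≤n⇒m≤1+n (Anc⇒depth-≤ a rv rz)

  Anc∧depth≤⇒≡ : ∀ {z v k k′} → Anc g par z v → RootDepth g par v k → RootDepth g par z k′ →
                 k ≤ k′ → z ≡ v
  Anc∧depth≤⇒≡ self       _           _  _    = refl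
  Anc∧depth≤⇒≡ (up v≢g _) root        _  _    = ⊥-elim (v≢g refl)
  Anc∧depth≤⇒≡ (up _ a)   (step _ rv) rz k≤k′ = ⊥-elim (≤⇒≯ (Anc⇒depth-≤ a rv rz) k≤k′)

  Anc? : ∀ z {v k} → RootDepth g par v k → Dec (Anc g par z v)
  Anc? z root with z ≟ g
  ... | yes refl = yes self
  ... | no z≢g   = no λ { self → z≢g refl ; (up g≢g _) → g≢g refl }
  Anc? z (step {v} v≢g r) with z ≟ v
  ... | yes refl = yes self
  ... | no z≢v with Anc? z r
  ...   | yes a = yes (up v≢g a)
  ...   | no ¬a = no λ { self → z≢v refl ; (up _ a) → ¬a a }

  root-Anc : ∀ {v k} → RootDepth g par v k → Anc g par g v
  root-Anc root         = self
  root-Anc (step v≢g r) = up v≢g (root-Anc r)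

  lowestAncestor : ∀ {P : Fin n → Set} → Decidable P → P g → ∀ {x k} → RootDepth g par x k →
                   ∃ λ w → Anc g par w x × P w × (∀ w′ → Anc g par w′ x → P w′ → Anc g par w′ w)
  lowestAncestor P? Pg root = _ , self , Pg , λ { _ self _ → self ; _ (up g≢g _) _ → ⊥-elim (g≢g refl) }
  lowestAncestor P? Pg (step {v} v≢g r) with P? v
  ... | yes Pv = v , self , Pv , λ _ a _ → a
  ... | no ¬Pv with w , w≼pv , Pw , lowest ← lowestAncestor P? Pg r =
    w , up v≢g w≼pv , Pw , λ { _ self Pv → ⊥-elim (¬Pv Pv) ; w′ (up _ a) Pw′ → lowest w′ a Pw′ }

  module Rooted (rooted : IsRootedTree g par) where

    depth : Fin n → ℕ
    depth v = proj₁ (rooted v)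

    depthOf : ∀ v → RootDepth g par v (depth v)
    depthOf v = proj₂ (rooted v)

    _≼?_ : ∀ z v → Dec (Anc g par z v)
    z ≼? v = Anc? z (depthOf v)

    lca : ∀ x y → ∃ (IsLCA g par x y)
    lca x y = lowestAncestor (_≼? y) (root-Anc (depthOf y)) (depthOf x)

    LCAClosed : List (Fin n) → Set
    LCAClosed P = ∀ {x y w} → x ∈ P → y ∈ P → IsLCA g par x y w → w ∈ P

    shallowest : Fin n → List (Fin n) → Fin n
    shallowest = argmin depth

    shallowest-∈ : ∀ {s P} → s ∈ P → shallowest s P ∈ P
    shallowest-∈ {s} {P} s∈ with argmin-sel depth s P
    ... | inj₁ t≡s = subst (_∈ P) (sym t≡s) s∈
    ... | inj₂ t∈  = t∈

    -- The least common ancestor of the shallowest vertex t and any v lies in P,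
    -- so it is at least as deep as t; being an ancestor of t, it is t.
    shallowest-Anc : ∀ {s P} → LCAClosed P → s ∈ P → ∀ {v} → v ∈ P → Anc g par (shallowest s P) v
    shallowest-Anc {s} {P} closed s∈ {v} v∈ with w , w≼t , w≼v , lowest ← lca (shallowest s P) v =
      subst (λ u → Anc g par u v) (Anc∧depth≤⇒≡ w≼t (depthOf _) (depthOf w) t≤w) w≼v
      where
      t≤w : depth (shallowest s P) ≤ depth w
      t≤w = All.lookup (f[argmin]≤f[xs] s P) (closed (shallowest-∈ s∈) v∈ (w≼t , w≼v , lowest))

module Construction {n m} (E : Edges n) (tree : IsTree E) (D : Fin m → Demand E)
                    (g : Fin n) (par : Fin n → Fin n) (decomp : IsTreeDecomp E D g par)
                    (ℓ : ℕ) (depth≤ℓ : ∀ v k → RootDepth g par v k → k ≤ ℓ) where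
  open Walks {n} {E}
  open TreeGeometry tree
  open RootedTree g par
  open Rooted (proj₁ decomp)
  open import Data.List.Membership.DecPropositional (≡-dec (_≟_ {n}) (_≟_ {n})) using (_∈?_)

  connected : ∀ u v → ∃ λ p → Walk E u v p
  connected = proj₁ (proj₂ tree)

  top : Fin m → Fin n
  top d = shallowest (src (D d)) (vs (D d))

  top∈path : ∀ d → top d ∈ vs (D d)
  top∈path d = shallowest-∈ (walk-head (walk (D d)))

  top-Anc : ∀ d {v} → v ∈ vs (D d) → Anc g par (top d) v
  top-Anc d = shallowest-Anc (proj₁ (proj₂ decomp) d _ _ _) (walk-head (walk (D d)))

  Adj? : ∀ a b → Dec (Adj E a b)
  Adj? a b = ((a , b) ∈? E) ⊎-dec ((b , a) ∈? E)

  Pivot? : ∀ z v → Dec (Pivot E g par z v)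
  Pivot? z v = ¬? (z ≼? v) ×-dec any? (λ u → z ≼? u ×-dec Adj? u v)

  pivots : Fin n → List (Fin n)
  pivots z = filter (Pivot? z) (allFin n)

  pivots-size : ∀ z → HasSize (Pivot E g par z) (length (pivots z))
  pivots-size z = pivots z , filter⁺ (Pivot? z) (allFin⁺ n) ,
                  (λ v v∈ → proj₂ (∈-filter⁻ (Pivot? z) {xs = allFin n} v∈)) ,
                  (λ v pivot → ∈-filter⁺ (Pivot? z) (∈-allFin v) pivot) , refl

  hubs : Fin m → List (Fin n)
  hubs d = top d ∷ pivots (top d)

  gate : Fin m → Fin n → Fin n
  gate d q = firstIn (vs (D d)) (proj₁ (connected q (src (D d)))) q

  criticalAt : Fin m → Fin n → List (Fin n × Fin n)
  criticalAt d q = edgesAt (gate d q) (vs (D d))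

  critical : Fin m → List (Fin n × Fin n)
  critical d = concatMap (criticalAt d) (hubs d)

  layer : Fin m → Fin ℓ
  layer d = fromℕ< (∸-monoʳ-< (RootDepth-pos (depthOf (top d))) (depth≤ℓ _ _ (depthOf (top d))))

  critical-size : ∀ d → length (critical d) ≤ 2 * suc (length (pivots (top d)))
  critical-size d =
    length-concatMap-≤ (criticalAt d) (λ q → length-edgesAt (gate d q) (vs (D d))) (hubs d)

  critical⊆path : ∀ d → All (EdgeOf (vs (D d))) (critical d)
  critical⊆path d =
    All.concat⁺ (All.map⁺ (All.tabulate {xs = hubs d} λ {q} _ → edgesAt-sound (gate d q) (vs (D d))))

  layer-order : ∀ {d₁ d₂} → toℕ (layer d₁) ≤ toℕ (layer d₂) → depth (top d₂) ≤ depth (top d₁)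
  layer-order le = ∸-cancelʳ-≤ (depth≤ℓ _ _ (depthOf _)) (subst₂ _≤_ (toℕ-fromℕ< _) (toℕ-fromℕ< _) le)

  -- Either t₁ = t₂ by depth, or path(d₂) runs from a ∈ C(t₁) to t₂ ∉ C(t₁) and
  -- so leaves C(t₁) through a pivot of t₁.
  hub-on-path : ∀ {d₁ d₂ a} → depth (top d₂) ≤ depth (top d₁) → a ∈ vs (D d₁) → a ∈ vs (D d₂) →
                ∃ λ q → q ∈ hubs d₁ × q ∈ vs (D d₂)
  hub-on-path {d₁} {d₂} shallower a∈₁ a∈₂ with top d₁ ≼? top d₂
  ... | yes t₁≼t₂ = top d₁ , here refl ,
        subst (_∈ vs (D d₂)) (sym (Anc∧depth≤⇒≡ t₁≼t₂ (depthOf _) (depthOf _) shallower)) (top∈path d₂)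
  ... | no t₁⋠t₂ =
        let S                = subpath (walk (D d₂)) (simple (D d₂)) a∈₂ (top∈path d₂)
            v , v∈S , pivot = walk-leaves (top d₁ ≼?_) (walks S) (top-Anc d₁ a∈₁) t₁⋠t₂
        in v , there (∈-filter⁺ (Pivot? (top d₁)) (∈-allFin v) pivot) , ⊆path S v∈S

  critical-hits : ∀ d₁ d₂ → toℕ (layer d₁) ≤ toℕ (layer d₂) → Overlap (D d₁) (D d₂) →
                  Any (EdgeOf (vs (D d₂))) (critical d₁)
  critical-hits d₁ d₂ le (a , b , ab₁ , ab₂) =
    let q , q∈hubs , q∈P₂ = hub-on-path (layer-order le) (proj₁ (EdgeIn-∈ ab₁)) (proj₁ (EdgeIn-∈ ab₂))
        y , xy₁ , xy₂      = sharedEdgeAtGate (walk (D d₁)) (simple (D d₁)) (walk (D d₂)) (simple (D d₂))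
                                              q∈P₂ (proj₂ (connected q (src (D d₁)))) ab₁ ab₂
    in Any.concatMap⁺ (criticalAt d₁) (lose q∈hubs (edgesAt-hits (simple (D d₁)) xy₁ xy₂))

lemma3 : ∀ {n m} (E : Edges n) → IsTree E → (D : Fin m → Demand E)
         → (g : Fin n) (par : Fin n → Fin n) → IsTreeDecomp E D g par
         → (θ ℓ : ℕ) → PivotSize E g par θ → Depth g par ℓ
         → Σ (Fin m → Fin ℓ) λ grp → Σ (Fin m → List (Fin n × Fin n)) λ π
             → IsLayeredDecomp E D ℓ grp π × CriticalSizeAtMost π (2 * (θ + 1))
lemma3 E tree D g par decomp θ ℓ (pivots≤θ , _) (depth≤ℓ , _) =
  layer , critical , (critical⊆path , critical-hits) , critical≤
  where
  open Construction E tree D g par decomp ℓ depth≤ℓ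

  critical≤ : CriticalSizeAtMost critical (2 * (θ + 1))
  critical≤ d = begin
    length (critical d)               ≤⟨ critical-size d ⟩
    2 * suc (length (pivots (top d))) ≤⟨ *-monoʳ-≤ 2 (s≤s (pivots≤θ (top d) _ (pivots-size (top d)))) ⟩
    2 * suc θ                         ≡⟨ cong (2 *_) (+-comm 1 θ) ⟩
    2 * (θ + 1)                       ∎
    where open ≤-Reasoning
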